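{- Let $\Gamma=(V,E)$ be a simple graph of order $n$ and size $m$. Then the global dual alliance number of $\Gamma$ satisfies $$\gamma_{a_d}(\Gamma)\ge \left\lceil\frac{\sqrt{2m+n}}{2}\right\rceil,$$ and the global strong dual alliance number of $\Gamma$ satisfies $$\gamma_{\hat a_d}(\Gamma)\ge \left\lceil\frac{1+\sqrt{1+8(n+m)}}{4}\right\rceil.$$
   Context: For $S\subseteq V$ and $v\in V$, let $N_S(v)=\{u\in S: u\sim v\}$ and $N_{V\setminus S}(v)=\{u\in V\setminus S: u\sim v\}$. A nonempty set $S\subseteq V$ is a global dual alliance if (i) $|N_S(v)|+1\ge |N_{V\setminus S}(v)|$ for every $v\in S$ and (ii) $|N_S(v)|\ge |N_{V\setminus S}(v)|+1$ for every $v\in V\setminus S$. It is a global strong dual alliance if (i') $|N_S(v)|\ge |N_{V\setminus S}(v)|$ for every $v\in S$ and (ii') $|N_S(v)|\ge |N_{V\setminus S}(v)|+2$ for every $v\in V\setminus S$. $\gamma_{a_d}(\Gamma)$ (resp. $\gamma_{\hat a_d}(\Gamma)$) is the minimum cardinality of a global dual (resp. global strong dual) alliance. -}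

module Defs where

open import Data.Nat using (ℕ; _+_; _*_; _≤_; _∸_; _<ᵇ_)
open import Data.Bool using (Bool; true; false; _∧_; not; if_then_else_)
open import Data.Fin using (Fin; toℕ)
open import Data.Fin.Subset using (Subset; _∈_; _∉_; Nonempty)
open import Data.List using (List; map; allFin)
open import Data.Nat.ListAction using (sum)
open import Data.Vec using (lookup)
open import Data.Product using (_×_)
open import Relation.Binary.PropositionalEquality using (_≡_)

record Graph (n : ℕ) : Set where
  field
    adj    : Fin n → Fin n → Bool
    sym    : ∀ u v → adj u v ≡ adj v u
    irrefl : ∀ v → adj v v ≡ false
open Graph public

count : ∀ {n} → (Fin n → Bool) → ℕ
count {n} p = sum (map (λ i → if p i then 1 else 0) (allFin n))

size : ∀ {n} → Graph n → ℕ
size G = sum (map (λ u → count (λ v → (toℕ u <ᵇ toℕ v) ∧ adj G u v)) (allFin _))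

NS : ∀ {n} → Graph n → Subset n → Fin n → ℕ
NS G S v = count (λ u → lookup S u ∧ adj G u v)

NVS : ∀ {n} → Graph n → Subset n → Fin n → ℕ
NVS G S v = count (λ u → not (lookup S u) ∧ adj G u v)

IsGlobalDualAlliance : ∀ {n} → Graph n → Subset n → Set
IsGlobalDualAlliance G S =
  Nonempty S
  × (∀ v → v ∈ S → NVS G S v ≤ NS G S v + 1)
  × (∀ v → v ∉ S → NVS G S v + 1 ≤ NS G S v)

IsGlobalStrongDualAlliance : ∀ {n} → Graph n → Subset n → Set
IsGlobalStrongDualAlliance G S =
  Nonempty S
  × (∀ v → v ∈ S → NVS G S v ≤ NS G S v)
  × (∀ v → v ∉ S → NVS G S v + 2 ≤ NS G S v)

IsLeast : (ℕ → Set) → ℕ → Set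
IsLeast P c = P c × (∀ k → P k → c ≤ k)

-- "√a / 2 ≤ k"  (for naturals, both sides ≥ 0):  a ≤ (2k)²
SqrtHalfLE : ℕ → ℕ → Set
SqrtHalfLE a k = a ≤ (2 * k) * (2 * k)

-- "(1 + √b) / 4 ≤ k":  1 ≤ 4k and b ≤ (4k - 1)²
OnePlusSqrtQuarterLE : ℕ → ℕ → Set
OnePlusSqrtQuarterLE b k = (1 ≤ 4 * k) × (b ≤ (4 * k ∸ 1) * (4 * k ∸ 1))

IsCeilSqrtHalf : ℕ → ℕ → Set
IsCeilSqrtHalf a = IsLeast (SqrtHalfLE a)

IsCeilOnePlusSqrtQuarter : ℕ → ℕ → Set
IsCeilOnePlusSqrtQuarter b = IsLeast (OnePlusSqrtQuarterLE b)

-- Let S be an alliance with s = ∣ S ∣ and s′ = ∣ ∁ S ∣, let inner and outer be the degree sums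
-- of the subgraphs induced by S and ∁ S, and cut the number of edges between S and ∁ S, so
-- that 2m = inner + 2 cut + outer and n = s + s′.  A vertex of S has at most s − 1 neighbours
-- in S, so inner + s ≤ s².  Summing the alliance conditions over S and over ∁ S gives
-- cut ≤ inner + s and outer + s′ ≤ cut for a dual alliance, and cut ≤ inner and
-- outer + 2s′ ≤ cut for a strong one.  Eliminating cut and outer yields
-- 2m + n ≤ 4 (inner + s) ≤ (2s)² and 1 + 8 (n + m) ≤ 1 + 8s + 16 inner ≤ (4s − 1)²,
-- which are exactly the inequalities whose least solutions are the two ceilings.
{-# OPTIONS --safe #-}
module Submission where

open import Defs hiding (sym)
open import Data.Bool using (Bool; true; false; _∧_; not; if_then_else_)
open import Data.Fin using (Fin; zero; suc; toℕ)
open import Data.Fin.Properties using (toℕ-injective)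
open import Data.Fin.Subset using (Subset; ∣_∣; _∈_; _∉_; ∁; Nonempty)
open import Data.Fin.Subset.Properties
  using (∣⁅x⁆∣≡1; x∈⁅y⁆⇒x≡y; p⊆q⇒∣p∣≤∣q∣; ∣∁p∣≡n∸∣p∣; ∣p∣≤n; x∈∁p⇒x∉p)
open import Data.List using (map; tabulate)
import Data.Nat.ListAction as List
open import Data.Nat using (ℕ; zero; suc; _+_; _*_; _∸_; _≤_; _<_; _<ᵇ_; z≤n; s≤s; z<s)
open import Data.Nat.Properties
open import Data.Nat.Tactic.RingSolver using (solve-∀)
open import Data.Product using (_×_; _,_)
open import Data.Vec using ([]; _∷_; lookup)
open import Data.Vec.Properties using (lookup-map; []=⇒lookup; lookup⇒[]=)
open import Relation.Binary.Definitions using (tri<; tri≈; tri>)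
open import Relation.Binary.PropositionalEquality
  using (_≡_; refl; sym; trans; cong; cong₂; subst; subst₂; module ≡-Reasoning)
open import Relation.Nullary using (¬_)
open import Relation.Nullary.Reflects using (ofʸ; ofⁿ; det)

open import Algebra.Properties.Semiring.Sum +-*-semiring
  using (sum-syntax; ∑-distrib-+; ∑-comm; *-distribˡ-sum; sum-cong-≗)

𝟙 : Bool → ℕ
𝟙 b = if b then 1 else 0

𝟙-∧ : ∀ a b → 𝟙 (a ∧ b) ≡ 𝟙 a * 𝟙 b
𝟙-∧ true  b = sym (+-identityʳ (𝟙 b))
𝟙-∧ false b = refl

𝟙-partition : ∀ b x → 𝟙 b * x + 𝟙 (not b) * x ≡ x
𝟙-partition true  = solve-∀
𝟙-partition false = solve-∀

sum-map-tabulate : ∀ {a} {A : Set a} {n} (f : A → ℕ) (g : Fin n → A) →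
                   List.sum (map f (tabulate g)) ≡ ∑[ i < n ] f (g i)
sum-map-tabulate {n = zero}  f g = refl
sum-map-tabulate {n = suc n} f g = cong (f (g zero) +_) (sum-map-tabulate f (λ i → g (suc i)))

count≡∑ : ∀ {n} (p : Fin n → Bool) → count p ≡ ∑[ i < n ] 𝟙 (p i)
count≡∑ p = sum-map-tabulate (λ i → 𝟙 (p i)) (λ i → i)

∑-mono-≤ : ∀ {n} {f g : Fin n → ℕ} → (∀ i → f i ≤ g i) → ∑[ i < n ] f i ≤ ∑[ i < n ] g i
∑-mono-≤ {zero}  f≤g = z≤n
∑-mono-≤ {suc n} f≤g = +-mono-≤ (f≤g zero) (∑-mono-≤ (λ i → f≤g (suc i)))

∑-mono-< : ∀ {n} {f g : Fin n → ℕ} → (∀ i → f i ≤ g i) → ∀ j → f j < g j →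
           ∑[ i < n ] f i < ∑[ i < n ] g i
∑-mono-< f≤g zero    fj<gj = +-mono-<-≤ fj<gj (∑-mono-≤ (λ i → f≤g (suc i)))
∑-mono-< f≤g (suc j) fj<gj = +-mono-≤-< (f≤g zero) (∑-mono-< (λ i → f≤g (suc i)) j fj<gj)

sumOver : ∀ {n} → Subset n → (Fin n → ℕ) → ℕ
sumOver {n} S f = ∑[ v < n ] (𝟙 (lookup S v) * f v)

syntax sumOver S (λ v → x) = ∑[ v ∈ S ] x

sumOver-const : ∀ {n} (S : Subset n) k → ∑[ v ∈ S ] k ≡ k * ∣ S ∣
sumOver-const []          k = sym (*-zeroʳ k)
sumOver-const (false ∷ S) k = sumOver-const S k
sumOver-const (true ∷ S)  k = begin
  1 * k + ∑[ v ∈ S ] k  ≡⟨ cong₂ _+_ (*-identityˡ k) (sumOver-const S k) ⟩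
  k + k * ∣ S ∣         ≡⟨ *-suc k ∣ S ∣ ⟨
  k * suc ∣ S ∣         ∎
  where open ≡-Reasoning

module _ {n : ℕ} where

  sumOver-cong : ∀ (S : Subset n) {f g : Fin n → ℕ} → (∀ v → f v ≡ g v) →
                 ∑[ v ∈ S ] f v ≡ ∑[ v ∈ S ] g v
  sumOver-cong S f≡g = sum-cong-≗ {n} (λ v → cong (𝟙 (lookup S v) *_) (f≡g v))

  sumOver-distrib-+ : ∀ (S : Subset n) (f g : Fin n → ℕ) →
                      ∑[ v ∈ S ] (f v + g v) ≡ ∑[ v ∈ S ] f v + ∑[ v ∈ S ] g v
  sumOver-distrib-+ S f g = trans
    (sum-cong-≗ {n} (λ v → *-distribˡ-+ (𝟙 (lookup S v)) (f v) (g v)))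
    (∑-distrib-+ (λ v → 𝟙 (lookup S v) * f v) (λ v → 𝟙 (lookup S v) * g v))

  sumOver-+-const : ∀ (S : Subset n) (f : Fin n → ℕ) k →
                    ∑[ v ∈ S ] (f v + k) ≡ ∑[ v ∈ S ] f v + k * ∣ S ∣
  sumOver-+-const S f k =
    trans (sumOver-distrib-+ S f (λ _ → k)) (cong (∑[ v ∈ S ] f v +_) (sumOver-const S k))

  sumOver-partition : ∀ (S : Subset n) (f : Fin n → ℕ) →
                      ∑[ v ∈ S ] f v + ∑[ v ∈ ∁ S ] f v ≡ ∑[ v < n ] f v
  sumOver-partition S f = begin
    ∑[ v ∈ S ] f v + ∑[ v ∈ ∁ S ] f v
      ≡⟨ ∑-distrib-+ (λ v → 𝟙 (lookup S v) * f v) (λ v → 𝟙 (lookup (∁ S) v) * f v) ⟨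
    ∑[ v < n ] (𝟙 (lookup S v) * f v + 𝟙 (lookup (∁ S) v) * f v)
      ≡⟨ sum-cong-≗ {n} (λ v → trans
           (cong (λ b → 𝟙 (lookup S v) * f v + 𝟙 b * f v) (lookup-map v not S))
           (𝟙-partition (lookup S v) (f v))) ⟩
    ∑[ v < n ] f v
      ∎
    where open ≡-Reasoning

  private
    term-mono-≤ : ∀ (S : Subset n) {f g : Fin n → ℕ} → (∀ v → v ∈ S → f v ≤ g v) →
                  ∀ v → 𝟙 (lookup S v) * f v ≤ 𝟙 (lookup S v) * g v
    term-mono-≤ S f≤g v with lookup S v in Sv
    ... | false = z≤n
    ... | true  = *-monoʳ-≤ 1 (f≤g v (lookup⇒[]= v S Sv))

  sumOver-mono-≤ : ∀ (S : Subset n) {f g : Fin n → ℕ} → (∀ v → v ∈ S → f v ≤ g v) →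
                   ∑[ v ∈ S ] f v ≤ ∑[ v ∈ S ] g v
  sumOver-mono-≤ S f≤g = ∑-mono-≤ {n} (term-mono-≤ S f≤g)

  sumOver-mono-< : ∀ (S : Subset n) {f g : Fin n → ℕ} → (∀ v → v ∈ S → f v ≤ g v) →
                   ∀ {u} → u ∈ S → f u < g u → ∑[ v ∈ S ] f v < ∑[ v ∈ S ] g v
  sumOver-mono-< S {f} {g} f≤g {u} u∈S fu<gu = ∑-mono-< (term-mono-≤ S f≤g) u
    (subst (λ b → 𝟙 b * f u < 𝟙 b * g u) (sym ([]=⇒lookup u∈S)) (+-mono-<-≤ fu<gu z≤n))

<ᵇ-true : ∀ {m n} → m < n → (m <ᵇ n) ≡ true
<ᵇ-true {m} {n} m<n = det (<ᵇ-reflects-< m n) (ofʸ m<n)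

<ᵇ-false : ∀ {m n} → ¬ m < n → (m <ᵇ n) ≡ false
<ᵇ-false {m} {n} m≮n = det (<ᵇ-reflects-< m n) (ofⁿ m≮n)

module _ {n : ℕ} (G : Graph n) where

  edge : Fin n → Fin n → ℕ
  edge u v = 𝟙 (adj G u v)

  degree : Fin n → ℕ
  degree v = ∑[ u < n ] edge u v

  neighbours : Subset n → Fin n → ℕ
  neighbours S v = ∑[ u ∈ S ] edge u v

  forwardEdge : Fin n → Fin n → ℕ
  forwardEdge u v = 𝟙 ((toℕ u <ᵇ toℕ v) ∧ adj G u v)

  edge≡forwardEdge+backwardEdge : ∀ u v → edge u v ≡ forwardEdge u v + forwardEdge v u
  edge≡forwardEdge+backwardEdge u v with <-cmp (toℕ u) (toℕ v)
  ... | tri< u<v _ v≯u rewrite <ᵇ-true u<v | <ᵇ-false v≯u = sym (+-identityʳ (edge u v))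
  ... | tri> u≮v _ v<u rewrite <ᵇ-false u≮v | <ᵇ-true v<u = cong 𝟙 (Graph.sym G u v)
  ... | tri≈ _ u≡v _ rewrite toℕ-injective u≡v | <ᵇ-false (n≮n (toℕ v)) = cong 𝟙 (irrefl G v)

  size≡∑forwardEdge : size G ≡ ∑[ u < n ] ∑[ v < n ] forwardEdge u v
  size≡∑forwardEdge = trans
    (sum-map-tabulate (λ u → count (λ v → (toℕ u <ᵇ toℕ v) ∧ adj G u v)) (λ u → u))
    (sum-cong-≗ {n} (λ u → count≡∑ (λ v → (toℕ u <ᵇ toℕ v) ∧ adj G u v)))

  handshake : ∑[ v < n ] degree v ≡ 2 * size G
  handshake = begin
    ∑[ v < n ] ∑[ u < n ] edge u v
      ≡⟨ sum-cong-≗ {n} (λ v → trans (sum-cong-≗ {n} (λ u → edge≡forwardEdge+backwardEdge u v))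
                                 (∑-distrib-+ (λ u → forwardEdge u v) (λ u → forwardEdge v u))) ⟩
    ∑[ v < n ] (∑[ u < n ] forwardEdge u v + ∑[ u < n ] forwardEdge v u)
      ≡⟨ ∑-distrib-+ (λ v → ∑[ u < n ] forwardEdge u v) (λ v → ∑[ u < n ] forwardEdge v u) ⟩
    ∑[ v < n ] ∑[ u < n ] forwardEdge u v + ∑[ v < n ] ∑[ u < n ] forwardEdge v u
      ≡⟨ cong (_+ ∑[ v < n ] ∑[ u < n ] forwardEdge v u) (∑-comm (λ v u → forwardEdge u v)) ⟩
    ∑[ u < n ] ∑[ v < n ] forwardEdge u v + ∑[ v < n ] ∑[ u < n ] forwardEdge v u
      ≡⟨ cong₂ _+_ size≡∑forwardEdge size≡∑forwardEdge ⟨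
    size G + size G
      ≡⟨ cong (size G +_) (+-identityʳ (size G)) ⟨
    2 * size G
      ∎
    where open ≡-Reasoning

  neighbours-partition : ∀ S v → neighbours S v + neighbours (∁ S) v ≡ degree v
  neighbours-partition S v = sumOver-partition S (λ u → edge u v)

  NS≡neighbours : ∀ S v → NS G S v ≡ neighbours S v
  NS≡neighbours S v = trans (count≡∑ (λ u → lookup S u ∧ adj G u v))
                            (sum-cong-≗ {n} (λ u → 𝟙-∧ (lookup S u) (adj G u v)))

  NVS≡neighbours-∁ : ∀ S v → NVS G S v ≡ neighbours (∁ S) v
  NVS≡neighbours-∁ S v = trans (count≡∑ (λ u → not (lookup S u) ∧ adj G u v))
    (sum-cong-≗ {n} (λ u → trans (𝟙-∧ (not (lookup S u)) (adj G u v))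
                                 (cong (λ b → 𝟙 b * edge u v) (sym (lookup-map u not S)))))

  sumOver-neighbours-comm : ∀ S T → ∑[ v ∈ S ] neighbours T v ≡ ∑[ v ∈ T ] neighbours S v
  sumOver-neighbours-comm S T = begin
    ∑[ v < n ] (𝟙 (lookup S v) * ∑[ u < n ] (𝟙 (lookup T u) * edge u v))
      ≡⟨ sum-cong-≗ {n} (λ v → *-distribˡ-sum {n} (𝟙 (lookup S v)) _) ⟩
    ∑[ v < n ] ∑[ u < n ] (𝟙 (lookup S v) * (𝟙 (lookup T u) * edge u v))
      ≡⟨ ∑-comm (λ v u → 𝟙 (lookup S v) * (𝟙 (lookup T u) * edge u v)) ⟩
    ∑[ u < n ] ∑[ v < n ] (𝟙 (lookup S v) * (𝟙 (lookup T u) * edge u v))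
      ≡⟨ sum-cong-≗ {n} (λ u → sum-cong-≗ {n} (λ v → trans
           (x*[y*z]≡y*[x*z] (𝟙 (lookup S v)) (𝟙 (lookup T u)) (edge u v))
           (cong (λ b → 𝟙 (lookup T u) * (𝟙 (lookup S v) * 𝟙 b)) (Graph.sym G u v)))) ⟩
    ∑[ u < n ] ∑[ v < n ] (𝟙 (lookup T u) * (𝟙 (lookup S v) * edge v u))
      ≡⟨ sum-cong-≗ {n} (λ u → *-distribˡ-sum {n} (𝟙 (lookup T u)) _) ⟨
    ∑[ u < n ] (𝟙 (lookup T u) * ∑[ v < n ] (𝟙 (lookup S v) * edge v u))
      ∎
    where
    open ≡-Reasoning
    x*[y*z]≡y*[x*z] : ∀ x y z → x * (y * z) ≡ y * (x * z)
    x*[y*z]≡y*[x*z] = solve-∀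

  neighbours+1≤∣S∣ : ∀ {S v} → v ∈ S → neighbours S v + 1 ≤ ∣ S ∣
  neighbours+1≤∣S∣ {S} {v} v∈S = subst₂ _≤_ (+-comm 1 _) (*-identityˡ ∣ S ∣)
    (subst (neighbours S v <_) (sumOver-const S 1)
      (sumOver-mono-< S (λ u _ → 𝟙≤1 (adj G u v)) v∈S
        (subst (λ b → 𝟙 b < 1) (sym (irrefl G v)) z<s)))
    where
    𝟙≤1 : ∀ b → 𝟙 b ≤ 1
    𝟙≤1 true  = ≤-refl
    𝟙≤1 false = z≤n

module AllianceCounts {n : ℕ} (G : Graph n) (S : Subset n) where

  inner cut outer : ℕ
  inner = ∑[ v ∈ S ] neighbours G S v
  cut   = ∑[ v ∈ S ] neighbours G (∁ S) v
  outer = ∑[ v ∈ ∁ S ] neighbours G (∁ S) v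

  n≡∣S∣+∣∁S∣ : n ≡ ∣ S ∣ + ∣ ∁ S ∣
  n≡∣S∣+∣∁S∣ = sym (trans (cong (∣ S ∣ +_) (∣∁p∣≡n∸∣p∣ S)) (m+[n∸m]≡n (∣p∣≤n S)))

  2*size≡inner+2*cut+outer : 2 * size G ≡ inner + 2 * cut + outer
  2*size≡inner+2*cut+outer = begin
    2 * size G
      ≡⟨ handshake G ⟨
    ∑[ v < n ] degree G v
      ≡⟨ sumOver-partition S (degree G) ⟨
    ∑[ v ∈ S ] degree G v + ∑[ v ∈ ∁ S ] degree G v
      ≡⟨ cong₂ _+_ (degree-split S) (degree-split (∁ S)) ⟩
    (inner + cut) + (∑[ v ∈ ∁ S ] neighbours G S v + outer)
      ≡⟨ cong (λ c → (inner + cut) + (c + outer)) (sumOver-neighbours-comm G (∁ S) S) ⟩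
    (inner + cut) + (cut + outer)
      ≡⟨ regroup inner cut outer ⟩
    inner + 2 * cut + outer
      ∎
    where
    open ≡-Reasoning
    degree-split : ∀ T → ∑[ v ∈ T ] degree G v
                         ≡ ∑[ v ∈ T ] neighbours G S v + ∑[ v ∈ T ] neighbours G (∁ S) v
    degree-split T = trans (sumOver-cong T (λ v → sym (neighbours-partition G S v)))
                           (sumOver-distrib-+ T (neighbours G S) (neighbours G (∁ S)))
    regroup : ∀ i c o → (i + c) + (c + o) ≡ i + 2 * c + o
    regroup = solve-∀

  inner+∣S∣≤∣S∣² : inner + ∣ S ∣ ≤ ∣ S ∣ * ∣ S ∣
  inner+∣S∣≤∣S∣² = begin
    inner + ∣ S ∣                     ≡⟨ cong (inner +_) (*-identityˡ ∣ S ∣) ⟨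
    inner + 1 * ∣ S ∣                 ≡⟨ sumOver-+-const S (neighbours G S) 1 ⟨
    ∑[ v ∈ S ] (neighbours G S v + 1) ≤⟨ sumOver-mono-≤ S (λ _ → neighbours+1≤∣S∣ G) ⟩
    ∑[ v ∈ S ] ∣ S ∣                  ≡⟨ sumOver-const S ∣ S ∣ ⟩
    ∣ S ∣ * ∣ S ∣                     ∎
    where open ≤-Reasoning

  cut≤inner+k*∣S∣ : ∀ k → (∀ v → v ∈ S → NVS G S v ≤ NS G S v + k) →
                    cut ≤ inner + k * ∣ S ∣
  cut≤inner+k*∣S∣ k bound = begin
    cut                                   ≤⟨ sumOver-mono-≤ S (λ v v∈S →
                                               subst₂ (λ a b → a ≤ b + k)
                                                 (NVS≡neighbours-∁ G S v) (NS≡neighbours G S v)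
                                                 (bound v v∈S)) ⟩
    ∑[ v ∈ S ] (neighbours G S v + k)     ≡⟨ sumOver-+-const S (neighbours G S) k ⟩
    inner + k * ∣ S ∣                     ∎
    where open ≤-Reasoning

  outer+k*∣∁S∣≤cut : ∀ k → (∀ v → v ∉ S → NVS G S v + k ≤ NS G S v) →
                     outer + k * ∣ ∁ S ∣ ≤ cut
  outer+k*∣∁S∣≤cut k bound = begin
    outer + k * ∣ ∁ S ∣                     ≡⟨ sumOver-+-const (∁ S) (neighbours G (∁ S)) k ⟨
    ∑[ v ∈ ∁ S ] (neighbours G (∁ S) v + k) ≤⟨ sumOver-mono-≤ (∁ S) (λ v v∈∁S →
                                                 subst₂ (λ a b → a + k ≤ b)
                                                   (NVS≡neighbours-∁ G S v) (NS≡neighbours G S v)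
                                                   (bound v (x∈∁p⇒x∉p v∈∁S))) ⟩
    ∑[ v ∈ ∁ S ] neighbours G S v           ≡⟨ sumOver-neighbours-comm G (∁ S) S ⟩
    cut                                     ∎
    where open ≤-Reasoning

2m+n≤[2s]² : ∀ m n s {s′ i c o} → 2 * m ≡ i + 2 * c + o → n ≡ s + s′ →
             i + s ≤ s * s → c ≤ i + 1 * s → o + 1 * s′ ≤ c →
             2 * m + n ≤ (2 * s) * (2 * s)
2m+n≤[2s]² m n s {s′} {i} {c} {o} 2m≡ n≡ i+s≤s² c≤i+s o+s′≤c = begin
  2 * m + n                                ≡⟨ cong₂ _+_ 2m≡ n≡ ⟩
  i + 2 * c + o + (s + s′)                 ≡⟨ regroup i c o s s′ ⟩
  (i + s) + 2 * c + (o + 1 * s′)           ≤⟨ +-mono-≤ (+-monoʳ-≤ (i + s) (*-monoʳ-≤ 2 c≤i+s))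
                                                        (≤-trans o+s′≤c c≤i+s) ⟩
  (i + s) + 2 * (i + 1 * s) + (i + 1 * s)  ≡⟨ collect i s ⟩
  4 * (i + s)                              ≤⟨ *-monoʳ-≤ 4 i+s≤s² ⟩
  4 * (s * s)                              ≡⟨ square s ⟩
  (2 * s) * (2 * s)                        ∎
  where
  open ≤-Reasoning
  regroup : ∀ i c o s s′ → i + 2 * c + o + (s + s′) ≡ (i + s) + 2 * c + (o + 1 * s′)
  regroup = solve-∀
  collect : ∀ i s → (i + s) + 2 * (i + 1 * s) + (i + 1 * s) ≡ 4 * (i + s)
  collect = solve-∀
  square : ∀ s → 4 * (s * s) ≡ (2 * s) * (2 * s)
  square = solve-∀

1+8[n+m]≤[4s∸1]² : ∀ m n s {s′ i c o} → 2 * m ≡ i + 2 * c + o → n ≡ s + s′ → 1 ≤ s →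
                   i + s ≤ s * s → c ≤ i + 0 * s → o + 2 * s′ ≤ c →
                   1 + 8 * (n + m) ≤ (4 * s ∸ 1) * (4 * s ∸ 1)
1+8[n+m]≤[4s∸1]² m n (suc t) {s′} {i} {c} {o} 2m≡ n≡ (s≤s z≤n) i+s≤s² c≤i o+2s′≤c =
  +-cancelʳ-≤ (8 * s) _ _ (begin
    1 + 8 * (n + m) + 8 * s
      ≡⟨ cong (λ k → 1 + 8 * (k + m) + 8 * s) n≡ ⟩
    1 + 8 * (s + s′ + m) + 8 * s
      ≡⟨ regroup s s′ m ⟩
    1 + 16 * s + 4 * (2 * m) + 8 * s′
      ≡⟨ cong (λ k → 1 + 16 * s + 4 * k + 8 * s′) 2m≡ ⟩
    1 + 16 * s + 4 * (i + 2 * c + o) + 8 * s′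
      ≡⟨ regroup′ s i c o s′ ⟩
    1 + 16 * s + 4 * i + 8 * c + 4 * (o + 2 * s′)
      ≤⟨ +-mono-≤ (+-monoʳ-≤ (1 + 16 * s + 4 * i) (*-monoʳ-≤ 8 c≤i))
                  (*-monoʳ-≤ 4 (≤-trans o+2s′≤c c≤i)) ⟩
    1 + 16 * s + 4 * i + 8 * (i + 0 * s) + 4 * (i + 0 * s)
      ≡⟨ collect s i ⟩
    1 + 16 * (i + s)
      ≤⟨ +-monoʳ-≤ 1 (*-monoʳ-≤ 16 i+s≤s²) ⟩
    1 + 16 * (s * s)
      ≡⟨ square t ⟩
    (4 * s ∸ 1) * (4 * s ∸ 1) + 8 * s
      ∎)
  where
  open ≤-Reasoning
  s = suc t
  regroup : ∀ s s′ m → 1 + 8 * (s + s′ + m) + 8 * s ≡ 1 + 16 * s + 4 * (2 * m) + 8 * s′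
  regroup = solve-∀
  regroup′ : ∀ s i c o s′ → 1 + 16 * s + 4 * (i + 2 * c + o) + 8 * s′
                          ≡ 1 + 16 * s + 4 * i + 8 * c + 4 * (o + 2 * s′)
  regroup′ = solve-∀
  collect : ∀ s i → 1 + 16 * s + 4 * i + 8 * (i + 0 * s) + 4 * (i + 0 * s) ≡ 1 + 16 * (i + s)
  collect = solve-∀
  -- 4 * suc t ∸ 1 reduces to t + 3 * suc t, which the solver can handle.
  square : ∀ t → 1 + 16 * (suc t * suc t) ≡ (t + 3 * suc t) * (t + 3 * suc t) + 8 * suc t
  square = solve-∀

nonempty⇒1≤∣p∣ : ∀ {n} {p : Subset n} → Nonempty p → 1 ≤ ∣ p ∣
nonempty⇒1≤∣p∣ {p = p} (x , x∈p) = subst (_≤ ∣ p ∣) (∣⁅x⁆∣≡1 x)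
  (p⊆q⇒∣p∣≤∣q∣ (λ {y} y∈⁅x⁆ → subst (_∈ p) (sym (x∈⁅y⁆⇒x≡y x y∈⁅x⁆)) x∈p))

module _ {n : ℕ} (G : Graph n) (S : Subset n) where
  open AllianceCounts G S

  globalDualAlliance⇒SqrtHalfLE :
    IsGlobalDualAlliance G S → SqrtHalfLE (2 * size G + n) ∣ S ∣
  globalDualAlliance⇒SqrtHalfLE (_ , inS , outS) =
    2m+n≤[2s]² (size G) n ∣ S ∣ 2*size≡inner+2*cut+outer n≡∣S∣+∣∁S∣ inner+∣S∣≤∣S∣²
      (cut≤inner+k*∣S∣ 1 inS) (outer+k*∣∁S∣≤cut 1 outS)

  globalStrongDualAlliance⇒OnePlusSqrtQuarterLE :
    IsGlobalStrongDualAlliance G S → OnePlusSqrtQuarterLE (1 + 8 * (n + size G)) ∣ S ∣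
  globalStrongDualAlliance⇒OnePlusSqrtQuarterLE (nonempty , inS , outS) =
    ≤-trans 1≤∣S∣ (m≤n*m ∣ S ∣ 4) ,
    1+8[n+m]≤[4s∸1]² (size G) n ∣ S ∣ 2*size≡inner+2*cut+outer n≡∣S∣+∣∁S∣
      1≤∣S∣ inner+∣S∣≤∣S∣²
      (cut≤inner+k*∣S∣ 0 (λ v v∈S → ≤-trans (inS v v∈S) (m≤m+n _ 0)))
      (outer+k*∣∁S∣≤cut 2 outS)
    where
    1≤∣S∣ : 1 ≤ ∣ S ∣
    1≤∣S∣ = nonempty⇒1≤∣p∣ nonempty

theorem9 : ∀ (n : ℕ) (G : Graph n) →
    (∀ (S : Subset n) → IsGlobalDualAlliance G S →
       ∀ c → IsCeilSqrtHalf (2 * size G + n) c → c ≤ ∣ S ∣)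
    × (∀ (S : Subset n) → IsGlobalStrongDualAlliance G S →
       ∀ c → IsCeilOnePlusSqrtQuarter (1 + 8 * (n + size G)) c → c ≤ ∣ S ∣)
theorem9 n G =
  (λ S alliance c (_ , least) → least ∣ S ∣ (globalDualAlliance⇒SqrtHalfLE G S alliance)) ,
  (λ S alliance c (_ , least) →
     least ∣ S ∣ (globalStrongDualAlliance⇒OnePlusSqrtQuarterLE G S alliance))
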